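{- Let $\mathcal{L}=\{l_1,l_2,\dots,l_s\}$ be a set of $s$ integers with $0<l_1<l_2<\dots<l_s$. Suppose that $\mathcal{A}=\{A_1,\dots,A_m\}$ and $\mathcal{B}=\{B_1,\dots,B_m\}$ are two families of subsets of $[n]$ such that (i) $|A_i\cap B_j|\in\mathcal{L}$ for every pair $i<j$; (ii) $B_i\subseteq A_i$ for all $i\le m$, and $|A_i\cap B_i|\notin\mathcal{L}$ for every $k+2\le i\le m$, where $k$ is the maximum subset size in $\mathcal{B}$; (iii) $|\bigcap_{1\le j\le k+1}B_j|=|\bigcap_{B_j\in\mathcal{B}}B_j|<l_1$, and $A_i=B_i$ for every $i\le k+1$. If $n\ge\left[\binom{k^2+k}{l_1+1}+1\right]s+l_1$, then \[ m\le\binom{n-l_1}{s}+\binom{n-l_1}{s-1}+\cdots+\binom{n-l_1}{0}. \]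
   Context: $\binom{a}{b}$ denotes the usual binomial coefficient. -}

module Defs where

open import Data.Nat using (ℕ; zero; suc; _+_; _<ᵇ_)
open import Data.Nat.Combinatorics using (_C_)
open import Data.Fin using (Fin; toℕ)
open import Data.Fin.Subset using (Subset; ⋂)
open import Data.List using (List; map; filterᵇ; allFin)

binomSum : ℕ → ℕ → ℕ
binomSum N zero    = N C 0
binomSum N (suc s) = N C (suc s) + binomSum N s

-- intersection of B_j over the (0-based) indices j with toℕ j < r,
-- i.e. B_1 ∩ ... ∩ B_r in 1-based notation
capUpTo : {m n : ℕ} → (Fin m → Subset n) → ℕ → Subset n
capUpTo {m} B r = ⋂ (map B (filterᵇ (λ j → toℕ j <ᵇ r) (allFin m)))

capAll : {m n : ℕ} → (Fin m → Subset n) → Subset n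
capAll {m} B = ⋂ (map B (allFin m))

-- The proof is the polynomial (rank) method.  Let U = B_1 ∪ ⋯ ∪ B_{k+1}, so |U| ≤ k² + k.
-- Condition (iii) forces every B_j to meet U in more than l₁ points; fix S_j ⊆ B_j ∩ U with
-- |S_j| = l₁ + 1 and put
--     f_j(x) = x^{S_j} · ∏_{b ≥ 2, l_b ≠ |B_j|} (⟨x, B_j⟩ − l_b),
-- a multilinear polynomial.  Ordering the indices by |B_j| inside the first block and by
-- position after it, the matrix f_j(A_i) is triangular with nonzero diagonal, so the f_j are
-- linearly independent.  They lie in the span of the monomials x^{S ∪ T} with |S| = l₁ + 1,
-- S ⊆ U, T ∩ S = ∅ and |T| ≤ s − 1, whence m ≤ C(k² + k, l₁ + 1) · Σ_{i<s} C(n − l₁ − 1, i),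
-- and the hypothesis on n turns this into the claimed Σ_{i≤s} C(n − l₁, i).
--
-- Indices are 0-based
-- throughout (l zero = l₁, and s = t + 1 in the statement).
module Submission where

module IntegerLinearAlgebra where

  open import Data.Nat as ℕ using (ℕ; zero; suc; s≤s)
  import Data.Nat.Properties as ℕ
  open import Data.Nat.Induction using (<-rec)
  open import Data.Integer using (ℤ; _+_; _*_; -_; _-_; 0ℤ; 1ℤ; _≟_)
  open import Data.Integer.Properties
    using (+-*-semiring; +-identityʳ; *-identityˡ; *-distribʳ-+; *-zeroˡ; *-zeroʳ; *-assoc; neg-distribʳ-*; i*j≡0⇒i≡0∨j≡0)
  open import Data.Integer.Tactic.RingSolver using (solve-∀)
  open import Data.Fin as Fin using (Fin; zero; suc; punchIn)
  open import Data.Fin.Properties using (all?; ¬∀⟶∃¬; punchInᵢ≢i)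
  open import Data.Vec.Functional using (insertAt; foldr)
  open import Data.Vec.Functional.Properties using (insertAt-lookup; insertAt-punchIn)
  open import Data.Product using (∃; _,_)
  open import Data.Sum using (inj₁; inj₂)
  open import Function using (_∘_)
  open import Relation.Binary.PropositionalEquality
  open import Relation.Nullary using (yes; no; contradiction)

  open import Algebra.Properties.Semiring.Sum +-*-semiring public
    using (sum; sum-syntax; sum-replicate-zero; sum-cong-≗; sum-remove; ∑-distrib-+; ∑-comm; *-distribˡ-sum; *-distribʳ-sum)
  open ≡-Reasoning

  ∑-zero : ∀ {n} {f : Fin n → ℤ} → (∀ i → f i ≡ 0ℤ) → sum f ≡ 0ℤ
  ∑-zero {n} f≡0 = trans (sum-cong-≗ f≡0) (sum-replicate-zero n)

  ∑-single : ∀ {n} {f : Fin n → ℤ} (j : Fin n) → (∀ i → i ≢ j → f i ≡ 0ℤ) → sum f ≡ f j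
  ∑-single {suc n} {f} j others = begin
    sum f                        ≡⟨ sum-remove {i = j} f ⟩
    f j + ∑[ i < n ] f (punchIn j i) ≡⟨ cong (f j +_) (∑-zero (λ i → others _ (punchInᵢ≢i j i))) ⟩
    f j + 0ℤ                     ≡⟨ +-identityʳ (f j) ⟩
    f j                          ∎

  *-nonzero : ∀ {a b : ℤ} → a ≢ 0ℤ → b ≢ 0ℤ → a * b ≢ 0ℤ
  *-nonzero {a} a≢0 b≢0 ab≡0 with i*j≡0⇒i≡0∨j≡0 a ab≡0
  ... | inj₁ a≡0 = a≢0 a≡0
  ... | inj₂ b≡0 = b≢0 b≡0

  product : ∀ {t} → (Fin t → ℤ) → ℤ
  product = foldr _*_ 1ℤ

  product-zero : ∀ {t} (h : Fin t → ℤ) (b : Fin t) → h b ≡ 0ℤ → product h ≡ 0ℤ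
  product-zero h zero    hb≡0 = trans (cong (_* product (h ∘ suc)) hb≡0) (*-zeroˡ (product (h ∘ suc)))
  product-zero h (suc b) hb≡0 = trans (cong (h zero *_) (product-zero (h ∘ suc) b hb≡0)) (*-zeroʳ (h zero))

  product-nonzero : ∀ {t} (h : Fin t → ℤ) → (∀ b → h b ≢ 0ℤ) → product h ≢ 0ℤ
  product-nonzero {zero}  h _      ()
  product-nonzero {suc t} h h≢0 = *-nonzero (h≢0 zero) (product-nonzero (h ∘ suc) (h≢0 ∘ suc))

  record Relation {m D : ℕ} (v : Fin m → Fin D → ℤ) : Set where
    field
      coeff      : Fin m → ℤ
      nontrivial : ∃ λ j → coeff j ≢ 0ℤ
      vanishes   : ∀ d → ∑[ j < m ] (coeff j * v j d) ≡ 0ℤ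

  -- One step of Gaussian elimination.  Let a = v_p(0) ≠ 0 and write v' for v without its
  -- first coordinate.  A relation μ among the m vectors  a v_j' − v_j(0) v_p'  (j ≠ p)
  -- lifts to the relation  Σ_{j≠p} a μ_j v_j − (Σ_{j≠p} μ_j v_j(0)) v_p  among the v_j.
  eliminate : ∀ {m D} (v : Fin (suc m) → Fin (suc D) → ℤ) (p : Fin (suc m)) → v p zero ≢ 0ℤ →
              Relation (λ j d → v p zero * v (punchIn p j) (suc d) - v (punchIn p j) zero * v p (suc d)) →
              Relation v
  eliminate {m} {D} v p a≢0 reduced =
    record { coeff = c ; nontrivial = lifted-nontrivial ; vanishes = lifted-vanishes }
    where
    open Relation reduced renaming (coeff to μ)
    a : ℤ
    a = v p zero
    w : Fin m → Fin (suc D) → ℤ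
    w j = v (punchIn p j)
    μw : Fin (suc D) → ℤ
    μw d = ∑[ j < m ] (μ j * w j d)
    c : Fin (suc m) → ℤ
    c = insertAt (λ j → a * μ j) p (- μw zero)

    -- Coordinate d of the lifted combination is  a (Σ_j μ_j w_j(d)) − (Σ_j μ_j w_j(0)) v_p(d),
    -- which is 0 for d = 0 and, for d = d' + 1, is coordinate d' of the relation μ.
    lifted-sum : ∀ d → ∑[ j < suc m ] (c j * v j d) ≡ a * μw d - μw zero * v p d
    lifted-sum d = begin
      ∑[ j < suc m ] (c j * v j d)
        ≡⟨ sum-remove {i = p} (λ j → c j * v j d) ⟩
      c p * v p d + ∑[ j < m ] (c (punchIn p j) * w j d)
        ≡⟨ cong₂ _+_ (cong (_* v p d) (insertAt-lookup _ p _))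
                     (sum-cong-≗ λ j → cong (_* w j d) (insertAt-punchIn _ p _ j)) ⟩
      - μw zero * v p d + ∑[ j < m ] (a * μ j * w j d)
        ≡⟨ cong (- μw zero * v p d +_)
                (trans (sum-cong-≗ λ j → *-assoc a (μ j) (w j d)) (sym (*-distribˡ-sum a (λ j → μ j * w j d)))) ⟩
      - μw zero * v p d + a * μw d
        ≡⟨ swap (μw zero) (v p d) (a * μw d) ⟩
      a * μw d - μw zero * v p d
        ∎
      where swap : ∀ s x y → - s * x + y ≡ y - s * x
            swap = solve-∀

    reduced-sum : ∀ d → ∑[ j < m ] (μ j * (a * w j (suc d) - w j zero * v p (suc d)))
                        ≡ a * μw (suc d) - μw zero * v p (suc d)
    reduced-sum d = begin
      ∑[ j < m ] (μ j * (a * w j (suc d) - w j zero * z))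
        ≡⟨ sum-cong-≗ (λ j → regroup (μ j) a (w j (suc d)) (w j zero) z) ⟩
      ∑[ j < m ] (a * (μ j * w j (suc d)) + μ j * w j zero * - z)
        ≡⟨ ∑-distrib-+ (λ j → a * (μ j * w j (suc d))) (λ j → μ j * w j zero * - z) ⟩
      ∑[ j < m ] (a * (μ j * w j (suc d))) + ∑[ j < m ] (μ j * w j zero * - z)
        ≡⟨ cong₂ _+_ (sym (*-distribˡ-sum a (λ j → μ j * w j (suc d))))
                     (sym (*-distribʳ-sum (- z) (λ j → μ j * w j zero))) ⟩
      a * μw (suc d) + μw zero * - z
        ≡⟨ cong (a * μw (suc d) +_) (sym (neg-distribʳ-* (μw zero) z)) ⟩
      a * μw (suc d) - μw zero * z
        ∎
      where z : ℤ
            z = v p (suc d)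
            regroup : ∀ u a x y z → u * (a * x - y * z) ≡ a * (u * x) + u * y * - z
            regroup = solve-∀

    lifted-vanishes : ∀ d → ∑[ j < suc m ] (c j * v j d) ≡ 0ℤ
    lifted-vanishes zero    = trans (lifted-sum zero) (cancel a (μw zero))
      where cancel : ∀ a s → a * s - s * a ≡ 0ℤ
            cancel = solve-∀
    lifted-vanishes (suc d) = trans (lifted-sum (suc d)) (trans (sym (reduced-sum d)) (vanishes d))

    lifted-nontrivial : ∃ λ j → c j ≢ 0ℤ
    lifted-nontrivial with nontrivial
    ... | j , μj≢0 = punchIn p j , λ cj≡0 →
          *-nonzero a≢0 μj≢0 (trans (sym (insertAt-punchIn _ p _ j)) cj≡0)

  -- More than D vectors in ℤ^D are linearly dependent.  Induction on D: if every first
  -- coordinate is 0 drop that coordinate, otherwise eliminate it using a pivot v_p(0) ≠ 0.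
  dependence : ∀ D m → D ℕ.< m → (v : Fin m → Fin D → ℤ) → Relation v
  dependence zero (suc m) _ v = record { coeff = λ _ → 1ℤ ; nontrivial = zero , λ () ; vanishes = λ () }
  dependence (suc D) m D<m v with all? (λ j → v j zero ≟ 0ℤ)
  ... | yes firstZero = record
    { coeff = coeff ; nontrivial = nontrivial
    ; vanishes = λ { zero    → ∑-zero (λ j → trans (cong (coeff j *_) (firstZero j)) (*-zeroʳ (coeff j)))
                   ; (suc d) → vanishes d } }
    where open Relation (dependence D m (ℕ.<-trans (ℕ.n<1+n D) D<m) (λ j d → v j (suc d)))
  ... | no notAllZero with ¬∀⟶∃¬ m _ (λ j → v j zero ≟ 0ℤ) notAllZero
  dependence (suc D) (suc m) (s≤s D<m) v | no _ | p , a≢0 = eliminate v p a≢0 (dependence D m D<m _)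

  -- Rows of a "triangular" integer matrix with nonzero diagonal are independent.  The order
  -- is given by a key: M j i = 0 whenever i ≠ j and key i ≤ key j.  If Σ_j λ_j M_j = 0 then
  -- λ = 0, by strong induction on key j: in column j every other term λ_i M_ij vanishes,
  -- either because key i < key j (so λ_i = 0) or because key j ≤ key i (so M_ij = 0).
  triangular-independent : ∀ {m} (M : Fin m → Fin m → ℤ) (key : Fin m → ℕ) →
    (∀ i j → i ≢ j → key i ℕ.≤ key j → M j i ≡ 0ℤ) → (∀ j → M j j ≢ 0ℤ) →
    (λs : Fin m → ℤ) → (∀ i → ∑[ j < m ] (λs j * M j i) ≡ 0ℤ) → ∀ j → λs j ≡ 0ℤ
  triangular-independent {m} M key lower diagonal λs relation j =
    <-rec (λ v → ∀ j → key j ≡ v → λs j ≡ 0ℤ) step (key j) j refl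
    where
    step : ∀ v → (∀ {u} → u ℕ.< v → ∀ j → key j ≡ u → λs j ≡ 0ℤ) → ∀ j → key j ≡ v → λs j ≡ 0ℤ
    step _ smaller j refl with i*j≡0⇒i≡0∨j≡0 (λs j) (trans (sym (∑-single j others)) (relation j))
      where
      others : ∀ i → i ≢ j → λs i * M i j ≡ 0ℤ
      others i i≢j with key i ℕ.<? key j
      ... | yes lt = trans (cong (_* M i j) (smaller lt i refl)) (*-zeroˡ (M i j))
      ... | no ≮ = trans (cong (λs i *_) (lower j i (i≢j ∘ sym) (ℕ.≮⇒≥ ≮))) (*-zeroʳ (λs i))
    ... | inj₁ λj≡0 = λj≡0
    ... | inj₂ Mjj≡0 = contradiction Mjj≡0 (diagonal j)

  module _ {X : Set} where

    record Span (D : ℕ) (e : Fin D → X → ℤ) (g : X → ℤ) : Set where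
      field
        coeff     : Fin D → ℤ
        expansion : ∀ x → g x ≡ ∑[ d < D ] (coeff d * e d x)

    open Span

    span-cong : ∀ {D e g h} → (∀ x → g x ≡ h x) → Span D e g → Span D e h
    span-cong g≗h s = record { coeff = coeff s ; expansion = λ x → trans (sym (g≗h x)) (expansion s x) }

    span-zero : ∀ {D e} → Span D e (λ _ → 0ℤ)
    span-zero {e = e} = record { coeff = λ _ → 0ℤ ; expansion = λ x → sym (∑-zero (λ d → *-zeroˡ (e d x))) }

    span-+ : ∀ {D e g h} → Span D e g → Span D e h → Span D e (λ x → g x + h x)
    span-+ {D} {e} s t = record
      { coeff     = λ d → coeff s d + coeff t d
      ; expansion = λ x → trans (cong₂ _+_ (expansion s x) (expansion t x))
          (trans (sym (∑-distrib-+ (λ d → coeff s d * e d x) (λ d → coeff t d * e d x)))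
                 (sum-cong-≗ λ d → sym (*-distribʳ-+ (e d x) (coeff s d) (coeff t d))))
      }

    span-scale : ∀ {D e g} (a : ℤ) → Span D e g → Span D e (λ x → a * g x)
    span-scale {D} {e} a s = record
      { coeff     = λ d → a * coeff s d
      ; expansion = λ x → trans (cong (a *_) (expansion s x))
          (trans (*-distribˡ-sum a (λ d → coeff s d * e d x)) (sum-cong-≗ λ d → sym (*-assoc a (coeff s d) (e d x))))
      }

    span-∑ : ∀ {D e} k (g : Fin k → X → ℤ) → (∀ i → Span D e (g i)) → Span D e (λ x → ∑[ i < k ] g i x)
    span-∑ zero    g s = span-zero
    span-∑ (suc k) g s = span-+ (s zero) (span-∑ k (g ∘ suc) (s ∘ suc))

    span-basis : ∀ {D e} (d : Fin D) → Span D e (e d)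
    span-basis {D} {e} d = record
      { coeff = δ ; expansion = λ x → sym (trans (∑-single d (λ i i≢d → off i i≢d x)) (on x)) }
      where
      δ : Fin D → ℤ
      δ i with i Fin.≟ d
      ... | yes _ = 1ℤ
      ... | no  _ = 0ℤ
      off : ∀ i → i ≢ d → ∀ x → δ i * e i x ≡ 0ℤ
      off i i≢d x with i Fin.≟ d
      ... | yes i≡d = contradiction i≡d i≢d
      ... | no  _   = *-zeroˡ (e i x)
      on : ∀ x → δ d * e d x ≡ e d x
      on x with d Fin.≟ d
      ... | yes _   = *-identityˡ (e d x)
      ... | no d≢d = contradiction refl d≢d

    span-*ʳ : ∀ {D e g} (h : X → ℤ) → Span D e g → Span D (λ d x → e d x * h x) (λ x → g x * h x)
    span-*ʳ {D} {e} h s = record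
      { coeff     = coeff s
      ; expansion = λ x → trans (cong (_* h x) (expansion s x))
          (trans (*-distribʳ-sum (h x) (λ d → coeff s d * e d x)) (sum-cong-≗ λ d → *-assoc (coeff s d) (e d x) (h x)))
      }

    span-trans : ∀ {D D' e e' g} → (∀ d → Span D' e' (e d)) → Span D e g → Span D' e' g
    span-trans {D} {e = e} e⊆e' s = span-cong (λ x → sym (expansion s x))
      (span-∑ D (λ d x → coeff s d * e d x) (λ d → span-scale (coeff s d) (e⊆e' d)))

  -- If f_0, …, f_{m-1} lie in the span of D functions and, at suitable points
  -- p_i, the matrix f_j(p_i) is triangular with nonzero diagonal, then m ≤ D: otherwise the
  -- coefficient vectors of the f_j are dependent, and a relation Σ λ_j f_j = 0 evaluated at
  -- the points p_i forces λ = 0.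
  rank-bound : ∀ {X : Set} {m D} (e : Fin D → X → ℤ) (f : Fin m → X → ℤ) (p : Fin m → X)
    (key : Fin m → ℕ) → (∀ j → Span D e (f j)) →
    (∀ i j → i ≢ j → key i ℕ.≤ key j → f j (p i) ≡ 0ℤ) → (∀ j → f j (p j) ≢ 0ℤ) → m ℕ.≤ D
  rank-bound {m = m} {D} e f p key spans lower diagonal with m ℕ.≤? D
  ... | yes m≤D = m≤D
  ... | no m≰D =
    let (j , λj≢0) = nontrivial
    in  contradiction (triangular-independent (λ j i → f j (p i)) key lower diagonal coeff
                         (λ i → combination-vanishes (p i)) j) λj≢0
    where
    c : Fin m → Fin D → ℤ
    c j = Span.coeff (spans j)
    open Relation (dependence D m (ℕ.≰⇒> m≰D) c)
    -- Σ_j λ_j f_j vanishes identically, as its coefficient vector Σ_j λ_j c_j is zero.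
    combination-vanishes : ∀ x → ∑[ j < m ] (coeff j * f j x) ≡ 0ℤ
    combination-vanishes x = begin
      ∑[ j < m ] (coeff j * f j x)
        ≡⟨ sum-cong-≗ (λ j → trans (cong (coeff j *_) (Span.expansion (spans j) x))
                                    (*-distribˡ-sum (coeff j) (λ d → c j d * e d x))) ⟩
      ∑[ j < m ] ∑[ d < D ] (coeff j * (c j d * e d x))
        ≡⟨ ∑-comm (λ j d → coeff j * (c j d * e d x)) ⟩
      ∑[ d < D ] ∑[ j < m ] (coeff j * (c j d * e d x))
        ≡⟨ sum-cong-≗ (λ d → trans (sum-cong-≗ λ j → sym (*-assoc (coeff j) (c j d) (e d x)))
                                    (sym (*-distribʳ-sum (e d x) (λ j → coeff j * c j d)))) ⟩
      ∑[ d < D ] (∑[ j < m ] (coeff j * c j d) * e d x)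
        ≡⟨ ∑-zero (λ d → trans (cong (_* e d x) (vanishes d)) (*-zeroˡ (e d x))) ⟩
      0ℤ
        ∎

module SubsetFacts where

  open import Defs using (capUpTo)
  open import Data.Nat using (zero; suc; _+_; _*_; _≤_; _<_; _<ᵇ_; z≤n; s≤s)
  open import Data.Nat.Properties
  open import Data.Bool using (T?; _∨_)
  open import Data.Fin using (Fin; toℕ)
  open import Data.Fin.Subset
  open import Data.Fin.Subset.Properties
  open import Data.List using (List; []; _∷_; length; allFin)
  open import Data.List.Relation.Unary.All as All using (All; []; _∷_)
  import Data.List.Relation.Unary.All.Properties as All
  open import Data.List.Relation.Unary.Any using (here; there)
  open import Data.List.Membership.Propositional using () renaming (_∈_ to _∈ₗ_)
  open import Data.Vec.Base as Vec using ([]; _∷_)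
  open import Function using (_∘_)
  open import Data.Product using (∃; _×_; _,_)
  open import Relation.Binary.PropositionalEquality
  open import Relation.Nullary using (contradiction)

  ∣p∪q∣≤∣p∣+∣q∣ : ∀ {n} (p q : Subset n) → ∣ p ∪ q ∣ ≤ ∣ p ∣ + ∣ q ∣
  ∣p∪q∣≤∣p∣+∣q∣ []            []            = z≤n
  ∣p∪q∣≤∣p∣+∣q∣ (inside ∷ p)  (s ∷ q)       =
    s≤s (≤-trans (∣p∪q∣≤∣p∣+∣q∣ p q) (+-monoʳ-≤ ∣ p ∣ (∣p∣≤∣x∷p∣ s q)))
  ∣p∪q∣≤∣p∣+∣q∣ (outside ∷ p) (inside ∷ q)  =
    ≤-trans (s≤s (∣p∪q∣≤∣p∣+∣q∣ p q)) (≤-reflexive (sym (+-suc ∣ p ∣ ∣ q ∣)))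
  ∣p∪q∣≤∣p∣+∣q∣ (outside ∷ p) (outside ∷ q) = ∣p∪q∣≤∣p∣+∣q∣ p q

  ⊆-⋃ : ∀ {n} {X : Subset n} {Xs : List (Subset n)} → X ∈ₗ Xs → X ⊆ ⋃ Xs
  ⊆-⋃ {Xs = X ∷ Xs} (here refl) = p⊆p∪q (⋃ Xs)
  ⊆-⋃ {Xs = Y ∷ Xs} (there X∈)  = q⊆p∪q Y (⋃ Xs) ∘ ⊆-⋃ X∈

  ∣⋃∣≤ : ∀ {n k} {Xs : List (Subset n)} → All (λ X → ∣ X ∣ ≤ k) Xs → ∣ ⋃ Xs ∣ ≤ length Xs * k
  ∣⋃∣≤ {n} []                    = ≤-reflexive (∣⊥∣≡0 n)
  ∣⋃∣≤ {Xs = X ∷ Xs} (∣X∣≤k ∷ bounds) =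
    ≤-trans (∣p∪q∣≤∣p∣+∣q∣ X (⋃ Xs)) (+-mono-≤ ∣X∣≤k (∣⋃∣≤ bounds))

  ∈-⋂ : ∀ {n} {x : Fin n} {Xs : List (Subset n)} → All (x ∈_) Xs → x ∈ ⋂ Xs
  ∈-⋂ []          = ∈⊤
  ∈-⋂ (x∈X ∷ x∈Xs) = x∈p∩q⁺ (x∈X , ∈-⋂ x∈Xs)

  ∈-capUpTo : ∀ {m n} (B : Fin m → Subset n) r {x} → (∀ j → toℕ j < r → x ∈ B j) → x ∈ capUpTo B r
  ∈-capUpTo {m} B r x∈B = ∈-⋂ (All.map⁺ (All.map (λ {j} j<r → x∈B j (<ᵇ⇒< (toℕ j) r j<r))
                                                 (All.all-filter (λ j → T? (toℕ j <ᵇ r)) (allFin m))))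

  ⊆-card : ∀ {n} {X Y : Subset n} → X ⊆ Y → ∣ Y ∣ ≤ ∣ X ∣ → Y ⊆ X
  ⊆-card {X = []}          {[]}          _   _          = λ ()
  ⊆-card {X = inside ∷ X}  {outside ∷ Y} X⊆Y _ with X⊆Y Vec.here
  ... | ()
  ⊆-card {X = inside ∷ X}  {inside ∷ Y}  X⊆Y (s≤s ∣Y∣≤∣X∣) = in⊆in (⊆-card (drop-∷-⊆ X⊆Y) ∣Y∣≤∣X∣)
  ⊆-card {X = outside ∷ X} {outside ∷ Y} X⊆Y ∣Y∣≤∣X∣ = out⊆ (⊆-card (drop-∷-⊆ X⊆Y) ∣Y∣≤∣X∣)
  ⊆-card {X = outside ∷ X} {inside ∷ Y}  X⊆Y ∣Y∣<∣X∣ =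
    contradiction (p⊆q⇒∣p∣≤∣q∣ (drop-∷-⊆ X⊆Y)) (<⇒≱ ∣Y∣<∣X∣)

  choose-subset : ∀ {n} (X : Subset n) r → r ≤ ∣ X ∣ → ∃ λ S → S ⊆ X × ∣ S ∣ ≡ r
  choose-subset {n} X zero _ = ⊥ , ⊥⊆ , ∣⊥∣≡0 n
  choose-subset (inside ∷ X) (suc r) (s≤s r≤∣X∣) with choose-subset X r r≤∣X∣
  ... | S , S⊆X , ∣S∣≡r = inside ∷ S , in⊆in S⊆X , cong suc ∣S∣≡r
  choose-subset (outside ∷ X) (suc r) r<∣X∣ with choose-subset X (suc r) r<∣X∣
  ... | S , S⊆X , ∣S∣≡r = outside ∷ S , out⊆ S⊆X , ∣S∣≡r

  ⊆⇒∩≡ : ∀ {n} {A B : Subset n} → B ⊆ A → A ∩ B ≡ B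
  ⊆⇒∩≡ {A = A} {B} B⊆A = ⊆-antisym (p∩q⊆q A B) (λ x∈B → x∈p∩q⁺ (B⊆A x∈B , x∈B))

  ∪-∪-outside : ∀ {n} (S T R : Subset n) → (S ∪ T) ∪ R ≡ S ∪ (T ∪ (R ∩ ∁ S))
  ∪-∪-outside []            []      []            = refl
  ∪-∪-outside (inside ∷ S)  (_ ∷ T) (_ ∷ R)       = cong (inside ∷_) (∪-∪-outside S T R)
  ∪-∪-outside (outside ∷ S) (t ∷ T) (inside ∷ R)  = cong ((t ∨ inside) ∷_) (∪-∪-outside S T R)
  ∪-∪-outside (outside ∷ S) (t ∷ T) (outside ∷ R) = cong ((t ∨ outside) ∷_) (∪-∪-outside S T R)

module SubsetEnumeration where

  open import Defs using (binomSum)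
  open import Data.Nat using (ℕ; zero; suc; _+_; _≤_; s≤s)
  open import Data.Nat.Properties using (n≤0⇒n≡0; m≤n⇒m<n∨m≡n; m≤n⇒m≤1+n; ≤-reflexive)
  open import Data.Nat.Combinatorics using (_C_; nCk+nC[k+1]≡[n+1]C[k+1])
  open import Data.Fin.Subset
  open import Data.Fin.Subset.Properties using (⊆-refl; drop-∷-⊆; out⊆; in⊆in)
  open import Data.Vec.Base as Vec using ([]; _∷_)
  open import Data.List using (List; []; _∷_; [_]; _++_; map; length)
  open import Data.List.Properties using (length-map; length-++)
  open import Data.List.Relation.Unary.All as All using (All; []; _∷_)
  import Data.List.Relation.Unary.All.Properties as All
  open import Data.List.Relation.Unary.Any using (here)
  open import Data.List.Membership.Propositional using () renaming (_∈_ to _∈ₗ_)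
  open import Data.List.Membership.Propositional.Properties using (∈-map⁺; ∈-++⁺ˡ; ∈-++⁺ʳ)
  open import Data.Product using (_×_; _,_; map₂)
  open import Data.Sum using (inj₁; inj₂)
  open import Relation.Binary.PropositionalEquality using (_≡_; refl; cong; cong₂; trans; module ≡-Reasoning)

  ofSize : ∀ {n} → Subset n → ℕ → List (Subset n)
  ofSize []            zero    = [ [] ]
  ofSize []            (suc r) = []
  ofSize (outside ∷ U) r       = map (outside ∷_) (ofSize U r)
  ofSize (inside ∷ U)  zero    = map (outside ∷_) (ofSize U zero)
  ofSize (inside ∷ U)  (suc r) = map (inside ∷_) (ofSize U r) ++ map (outside ∷_) (ofSize U (suc r))

  length-ofSize : ∀ {n} (U : Subset n) r → length (ofSize U r) ≡ ∣ U ∣ C r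
  length-ofSize []            zero    = refl
  length-ofSize []            (suc r) = refl
  length-ofSize (outside ∷ U) r       = trans (length-map _ (ofSize U r)) (length-ofSize U r)
  length-ofSize (inside ∷ U)  zero    = trans (length-map _ (ofSize U zero)) (length-ofSize U zero)
  length-ofSize (inside ∷ U)  (suc r) = begin
    length (map (inside ∷_) (ofSize U r) ++ map (outside ∷_) (ofSize U (suc r)))
      ≡⟨ length-++ (map (inside ∷_) (ofSize U r)) ⟩
    length (map (inside ∷_) (ofSize U r)) + length (map (outside ∷_) (ofSize U (suc r)))
      ≡⟨ cong₂ _+_ (trans (length-map _ (ofSize U r)) (length-ofSize U r))
                   (trans (length-map _ (ofSize U (suc r))) (length-ofSize U (suc r))) ⟩
    ∣ U ∣ C r + ∣ U ∣ C suc r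
      ≡⟨ nCk+nC[k+1]≡[n+1]C[k+1] ∣ U ∣ r ⟩
    suc ∣ U ∣ C suc r
      ∎
    where open ≡-Reasoning

  private
    SizedSubsetOf : ∀ {n} → Subset n → ℕ → Subset n → Set
    SizedSubsetOf U r T = T ⊆ U × ∣ T ∣ ≡ r

    extend-outside : ∀ {n} {T U : Subset n} {r} s →
                     SizedSubsetOf U r T → SizedSubsetOf (s ∷ U) r (outside ∷ T)
    extend-outside _ (T⊆U , ∣T∣≡r) = out⊆ T⊆U , ∣T∣≡r

    extend-inside : ∀ {n} {T U : Subset n} {r} →
                    SizedSubsetOf U r T → SizedSubsetOf (inside ∷ U) (suc r) (inside ∷ T)
    extend-inside (T⊆U , ∣T∣≡r) = in⊆in T⊆U , cong suc ∣T∣≡r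

  ofSize-sound : ∀ {n} (U : Subset n) r → All (λ T → T ⊆ U × ∣ T ∣ ≡ r) (ofSize U r)
  ofSize-sound []            zero    = (⊆-refl , refl) ∷ []
  ofSize-sound []            (suc r) = []
  ofSize-sound (outside ∷ U) r       = All.map⁺ (All.map (extend-outside outside) (ofSize-sound U r))
  ofSize-sound (inside ∷ U)  zero    = All.map⁺ (All.map (extend-outside inside) (ofSize-sound U zero))
  ofSize-sound (inside ∷ U)  (suc r) = All.++⁺
    (All.map⁺ (All.map extend-inside (ofSize-sound U r)))
    (All.map⁺ (All.map (extend-outside inside) (ofSize-sound U (suc r))))

  ofSize-complete : ∀ {n} {T U : Subset n} {r} → T ⊆ U → ∣ T ∣ ≡ r → T ∈ₗ ofSize U r
  ofSize-complete {T = []}          {[]}          T⊆U refl = here refl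
  ofSize-complete {T = inside ∷ T}  {outside ∷ U} T⊆U _ with T⊆U Vec.here
  ... | ()
  ofSize-complete {T = inside ∷ T}  {inside ∷ U}  T⊆U refl =
    ∈-++⁺ˡ (∈-map⁺ (inside ∷_) (ofSize-complete (drop-∷-⊆ T⊆U) refl))
  ofSize-complete {T = outside ∷ T} {outside ∷ U} T⊆U ∣T∣≡r =
    ∈-map⁺ (outside ∷_) (ofSize-complete (drop-∷-⊆ T⊆U) ∣T∣≡r)
  ofSize-complete {T = outside ∷ T} {inside ∷ U} {zero}  T⊆U ∣T∣≡0 =
    ∈-map⁺ (outside ∷_) (ofSize-complete (drop-∷-⊆ T⊆U) ∣T∣≡0)
  ofSize-complete {T = outside ∷ T} {inside ∷ U} {suc r} T⊆U ∣T∣≡r =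
    ∈-++⁺ʳ (map (inside ∷_) (ofSize U r)) (∈-map⁺ (outside ∷_) (ofSize-complete (drop-∷-⊆ T⊆U) ∣T∣≡r))

  atMost : ∀ {n} → Subset n → ℕ → List (Subset n)
  atMost U zero    = ofSize U zero
  atMost U (suc s) = ofSize U (suc s) ++ atMost U s

  length-atMost : ∀ {n} (U : Subset n) s → length (atMost U s) ≡ binomSum ∣ U ∣ s
  length-atMost U zero    = length-ofSize U zero
  length-atMost U (suc s) = trans (length-++ (ofSize U (suc s)))
                                  (cong₂ _+_ (length-ofSize U (suc s)) (length-atMost U s))

  atMost-sound : ∀ {n} (U : Subset n) s → All (λ T → T ⊆ U × ∣ T ∣ ≤ s) (atMost U s)
  atMost-sound U zero    = All.map (map₂ ≤-reflexive) (ofSize-sound U zero)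
  atMost-sound U (suc s) = All.++⁺
    (All.map (map₂ ≤-reflexive) (ofSize-sound U (suc s)))
    (All.map (map₂ m≤n⇒m≤1+n) (atMost-sound U s))

  atMost-complete : ∀ {n} {T U : Subset n} s → T ⊆ U → ∣ T ∣ ≤ s → T ∈ₗ atMost U s
  atMost-complete zero    T⊆U ∣T∣≤0 = ofSize-complete T⊆U (n≤0⇒n≡0 ∣T∣≤0)
  atMost-complete {U = U} (suc s) T⊆U ∣T∣≤s with m≤n⇒m<n∨m≡n ∣T∣≤s
  ... | inj₂ ∣T∣≡s       = ∈-++⁺ˡ (ofSize-complete T⊆U ∣T∣≡s)
  ... | inj₁ (s≤s ∣T∣≤s′) = ∈-++⁺ʳ (ofSize U (suc s)) (atMost-complete s T⊆U ∣T∣≤s′)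

-- Multilinear polynomials over ℤ in the variables x_0, …, x_{n-1}, viewed as functions on
-- subsets of [n] (a subset stands for its 0/1 indicator vector).
module MultilinearPolynomials where

  open IntegerLinearAlgebra
  open SubsetEnumeration
  open SubsetFacts using (∣p∪q∣≤∣p∣+∣q∣; ∪-∪-outside)
  open import Defs using (binomSum)
  open import Data.Nat as ℕ using (ℕ; zero; suc; _∸_)
  import Data.Nat.Properties as ℕ
  open import Data.Integer using (ℤ; +_; _+_; _*_; -_; _-_; 0ℤ; 1ℤ)
  open import Data.Integer.Properties using (*-zeroʳ; *-identityʳ)
  open import Data.Integer.Tactic.RingSolver using (solve-∀)
  open import Data.Bool using (_∧_; if_then_else_)
  open import Data.Fin using (Fin; zero; suc)
  open import Data.Fin.Subset hiding (_-_)
  open import Data.Fin.Subset.Properties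
    using (⊆-refl; ⊥⊆; drop-∷-⊆; out⊆; in⊆in; p∩q⊆q; ∣p∩q∣≤∣p∣; ∣⁅x⁆∣≡1; x∈p∪q⁻; ∪-identityʳ;
           ∣⊥∣≡0; ∣∁p∣≡n∸∣p∣)
  open import Data.Vec.Base as Vec using ([]; _∷_; lookup)
  open import Data.List as List using (List; []; _∷_; map; concatMap; length)
  open import Data.List.Properties using (length-map; length-++)
  open import Data.List.Relation.Unary.All as All using (All; []; _∷_)
  open import Data.List.Relation.Unary.Any as Any using ()
  import Data.List.Relation.Unary.Any.Properties as Any
  open import Data.List.Membership.Propositional using () renaming (_∈_ to _∈ₗ_)
  open import Data.List.Membership.Propositional.Properties using (∈-map⁺; ∈-map⁻; ∈-lookup)
  open import Data.Product using (_,_)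
  open import Data.Sum using (_⊎_; inj₁; inj₂; [_,_]; map₂)
  open import Function using (_∘_)
  open import Relation.Binary.PropositionalEquality using (_≡_; refl; sym; trans; cong; cong₂; subst; module ≡-Reasoning)

  -- The monomial x^T at the indicator vector of x: 1 if T ⊆ x and 0 otherwise.
  monomial : ∀ {n} → Subset n → Subset n → ℤ
  monomial []            []            = 1ℤ
  monomial (inside ∷ T)  (inside ∷ x)  = monomial T x
  monomial (inside ∷ T)  (outside ∷ x) = 0ℤ
  monomial (outside ∷ T) (_ ∷ x)       = monomial T x

  monomial-⊆ : ∀ {n} {T x : Subset n} → T ⊆ x → monomial T x ≡ 1ℤ
  monomial-⊆ {T = []}          {[]}          _   = refl
  monomial-⊆ {T = inside ∷ T}  {inside ∷ x}  T⊆x = monomial-⊆ (drop-∷-⊆ T⊆x)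
  monomial-⊆ {T = inside ∷ T}  {outside ∷ x} T⊆x with T⊆x Vec.here
  ... | ()
  monomial-⊆ {T = outside ∷ T} {_ ∷ x}       T⊆x = monomial-⊆ (drop-∷-⊆ T⊆x)

  monomial-⊈ : ∀ {n} (T x : Subset n) → monomial T x ≡ 0ℤ ⊎ T ⊆ x
  monomial-⊈ []            []            = inj₂ ⊆-refl
  monomial-⊈ (inside ∷ T)  (outside ∷ x) = inj₁ refl
  monomial-⊈ (inside ∷ T)  (inside ∷ x)  = map₂ in⊆in (monomial-⊈ T x)
  monomial-⊈ (outside ∷ T) (_ ∷ x)       = map₂ out⊆ (monomial-⊈ T x)

  monomial-∪ : ∀ {n} (X Y x : Subset n) → monomial X x * monomial Y x ≡ monomial (X ∪ Y) x
  monomial-∪ []            []            []            = refl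
  monomial-∪ (inside ∷ X)  (_ ∷ Y)       (outside ∷ x) = refl
  monomial-∪ (inside ∷ X)  (inside ∷ Y)  (inside ∷ x)  = monomial-∪ X Y x
  monomial-∪ (inside ∷ X)  (outside ∷ Y) (inside ∷ x)  = monomial-∪ X Y x
  monomial-∪ (outside ∷ X) (inside ∷ Y)  (outside ∷ x) = *-zeroʳ (monomial X x)
  monomial-∪ (outside ∷ X) (inside ∷ Y)  (inside ∷ x)  = monomial-∪ X Y x
  monomial-∪ (outside ∷ X) (outside ∷ Y) (_ ∷ x)       = monomial-∪ X Y x

  size-linear : ∀ {n} (B x : Subset n) →
                + ∣ x ∩ B ∣ ≡ ∑[ v < n ] (if lookup B v then monomial ⁅ v ⁆ x else 0ℤ)
  size-linear []      []      = refl
  size-linear (b ∷ B) (s ∷ x) = trans (first b s) (cong (λ rest → head-term b s + rest) (size-linear B x))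
    where
    head-term : Side → Side → ℤ
    head-term b s = if b then monomial ⁅ zero ⁆ (s ∷ x) else 0ℤ
    first : ∀ b s → + ∣ (s ∧ b) ∷ (x ∩ B) ∣ ≡ head-term b s + + ∣ x ∩ B ∣
    first inside  inside  = cong (_+ + ∣ x ∩ B ∣) (sym (monomial-⊆ {T = ⊥} {x} ⊥⊆))
    first inside  outside = refl
    first outside inside  = refl
    first outside outside = refl

  SpannedBy : ∀ {n} → List (Subset n) → (Subset n → ℤ) → Set
  SpannedBy Ms = Span (length Ms) (λ d → monomial (List.lookup Ms d))

  spannedBy-monomial : ∀ {n} {M : Subset n} {Ms} → M ∈ₗ Ms → SpannedBy Ms (monomial M)
  spannedBy-monomial M∈Ms = span-cong (λ x → cong (λ M → monomial M x) (sym (Any.lookup-index M∈Ms)))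
                                      (span-basis (Any.index M∈Ms))

  spannedBy-⊆ : ∀ {n} {Ms Ns : List (Subset n)} {g} → (∀ {M} → M ∈ₗ Ms → M ∈ₗ Ns) →
                SpannedBy Ms g → SpannedBy Ns g
  spannedBy-⊆ Ms⊆Ns = span-trans (λ d → spannedBy-monomial (Ms⊆Ns (∈-lookup d)))

  -- The monomials x^{S ∪ T} with T disjoint from S and |T| ≤ s, i.e. x^S times the
  -- multilinear monomials of degree ≤ s in the variables outside S.
  monomialsAbove : ∀ {n} → Subset n → ℕ → List (Subset n)
  monomialsAbove S s = map (S ∪_) (atMost (∁ S) s)

  length-monomialsAbove : ∀ {n} (S : Subset n) s → length (monomialsAbove S s) ≡ binomSum (n ∸ ∣ S ∣) s
  length-monomialsAbove S s = trans (length-map (S ∪_) (atMost (∁ S) s))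
    (trans (length-atMost (∁ S) s) (cong (λ N → binomSum N s) (∣∁p∣≡n∸∣p∣ S)))

  Above : ∀ {n} → Subset n → ℕ → (Subset n → ℤ) → Set
  Above S s = SpannedBy (monomialsAbove S s)

  above-monomial : ∀ {n} {S T : Subset n} {s} → T ⊆ ∁ S → ∣ T ∣ ℕ.≤ s → Above S s (monomial (S ∪ T))
  above-monomial {s = s} T⊆∁S ∣T∣≤s = spannedBy-monomial (∈-map⁺ _ (atMost-complete s T⊆∁S ∣T∣≤s))

  above-*ʳ : ∀ {n} {S : Subset n} {s} {Ns} (h : Subset n → ℤ) →
    (∀ {T} → T ⊆ ∁ S → ∣ T ∣ ℕ.≤ s → SpannedBy Ns (λ x → monomial (S ∪ T) x * h x)) →
    ∀ {g} → Above S s g → SpannedBy Ns (λ x → g x * h x)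
  above-*ʳ {S = S} {s} {Ns} h generators g∈ = span-trans generator (span-*ʳ h g∈)
    where
    generator : ∀ d → SpannedBy Ns (λ x → monomial (List.lookup (monomialsAbove S s) d) x * h x)
    generator d with ∈-map⁻ (S ∪_) (∈-lookup {xs = monomialsAbove S s} d)
    ... | T , T∈ , M≡S∪T with All.lookup (atMost-sound (∁ S) s) T∈
    ...   | T⊆∁S , ∣T∣≤s = subst (λ M → SpannedBy Ns (λ x → monomial M x * h x)) (sym M≡S∪T)
                                 (generators T⊆∁S ∣T∣≤s)

  above-base : ∀ {n} (S : Subset n) → Above S 0 (monomial S)
  above-base {n} S = subst (Above S 0 ∘ monomial) (∪-identityʳ S)
                           (above-monomial {S = S} ⊥⊆ (ℕ.≤-reflexive (∣⊥∣≡0 n)))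

  above-weaken : ∀ {n} {S : Subset n} {s g} → Above S s g → Above S (suc s) g
  above-weaken {S = S} {s} {g} g∈ = span-cong (λ x → *-identityʳ (g x))
    (above-*ʳ {S = S} {s} {monomialsAbove S (suc s)} (λ _ → 1ℤ) generator g∈)
    where
    generator : ∀ {T} → T ⊆ ∁ S → ∣ T ∣ ℕ.≤ s → Above S (suc s) (λ x → monomial (S ∪ T) x * 1ℤ)
    generator T⊆∁S ∣T∣≤s = span-cong (λ x → sym (*-identityʳ _))
                                     (above-monomial {S = S} T⊆∁S (ℕ.m≤n⇒m≤1+n ∣T∣≤s))

  -- Multiplying by a variable x_v raises the degree by at most one: x^{S ∪ T} x_v = x^{S ∪ T'}
  -- with T' = T ∪ ({v} ∩ ∁S).
  above-*-variable : ∀ {n} {S : Subset n} {s g} (v : Fin n) → Above S s g →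
                     Above S (suc s) (λ x → g x * monomial ⁅ v ⁆ x)
  above-*-variable {n} {S} {s} v = above-*ʳ {S = S} {s} {monomialsAbove S (suc s)} (monomial ⁅ v ⁆) generator
    where
    generator : ∀ {T} → T ⊆ ∁ S → ∣ T ∣ ℕ.≤ s → Above S (suc s) (λ x → monomial (S ∪ T) x * monomial ⁅ v ⁆ x)
    generator {T} T⊆∁S ∣T∣≤s = span-cong
      (λ x → sym (trans (monomial-∪ (S ∪ T) ⁅ v ⁆ x) (cong (λ M → monomial M x) (∪-∪-outside S T ⁅ v ⁆))))
      (above-monomial {S = S} T'⊆∁S ∣T'∣≤1+s)
      where
      new : Subset n
      new = ⁅ v ⁆ ∩ ∁ S
      T'⊆∁S : T ∪ new ⊆ ∁ S
      T'⊆∁S = [ T⊆∁S , p∩q⊆q ⁅ v ⁆ (∁ S) ] ∘ x∈p∪q⁻ T new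
      ∣T'∣≤1+s : ∣ T ∪ new ∣ ℕ.≤ suc s
      ∣T'∣≤1+s = ℕ.≤-trans (∣p∪q∣≤∣p∣+∣q∣ T new) (ℕ.≤-trans
        (ℕ.+-mono-≤ ∣T∣≤s (ℕ.≤-trans (∣p∩q∣≤∣p∣ ⁅ v ⁆ (∁ S)) (ℕ.≤-reflexive (∣⁅x⁆∣≡1 v))))
        (ℕ.≤-reflexive (ℕ.+-comm s 1)))

  above-*-affine : ∀ {n} {S : Subset n} {s g} (B : Subset n) (c : ℕ) → Above S s g →
                   Above S (suc s) (λ x → g x * (+ ∣ x ∩ B ∣ - + c))
  above-*-affine {n} {S} {s} {g} B c g∈ = span-cong regroup
    (span-+ (span-∑ n (λ v x → g x * term v x) g*term)
            (span-scale (- + c) (above-weaken {S = S} g∈)))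
    where
    term : Fin n → Subset n → ℤ
    term v x = if lookup B v then monomial ⁅ v ⁆ x else 0ℤ
    g*term : ∀ v → Above S (suc s) (λ x → g x * term v x)
    g*term v with lookup B v
    ... | inside  = above-*-variable {S = S} {s} v g∈
    ... | outside = span-cong (λ x → sym (*-zeroʳ (g x))) span-zero
    regroup : ∀ x → ∑[ v < n ] (g x * term v x) + - + c * g x ≡ g x * (+ ∣ x ∩ B ∣ - + c)
    regroup x = begin
      ∑[ v < n ] (g x * term v x) + - + c * g x ≡⟨ cong (_+ - + c * g x) (sym (*-distribˡ-sum (g x) (λ v → term v x))) ⟩
      g x * ∑[ v < n ] term v x + - + c * g x   ≡⟨ cong (λ L → g x * L + - + c * g x) (sym (size-linear B x)) ⟩
      g x * + ∣ x ∩ B ∣ + - + c * g x           ≡⟨ factor (g x) (+ ∣ x ∩ B ∣) (+ c) ⟩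
      g x * (+ ∣ x ∩ B ∣ - + c)                 ∎
      where open ≡-Reasoning
            factor : ∀ a L c → a * L + - c * a ≡ a * (L - c)
            factor = solve-∀

  data Factor (n : ℕ) : Set where
    one    : Factor n
    affine : Subset n → ℕ → Factor n

  ⟦_⟧ : ∀ {n} → Factor n → Subset n → ℤ
  ⟦ one ⟧        x = 1ℤ
  ⟦ affine B c ⟧ x = + ∣ x ∩ B ∣ - + c

  above-*-factor : ∀ {n} {S : Subset n} {s g} (h : Factor n) → Above S s g →
                   Above S (suc s) (λ x → g x * ⟦ h ⟧ x)
  above-*-factor {S = S} {g = g} one          g∈ = span-cong (λ x → sym (*-identityʳ (g x))) (above-weaken {S = S} g∈)
  above-*-factor {S = S}         (affine B c) g∈ = above-*-affine {S = S} B c g∈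

  above-product : ∀ {n t} (S : Subset n) (hs : Fin t → Factor n) →
                  Above S t (λ x → monomial S x * product (λ b → ⟦ hs b ⟧ x))
  above-product {t = zero}  S hs = span-cong (λ x → sym (*-identityʳ (monomial S x))) (above-base S)
  above-product {t = suc t} S hs = span-cong (λ x → rotate (monomial S x) _ (⟦ hs zero ⟧ x))
    (above-*-factor {S = S} (hs zero) (above-product S (hs ∘ suc)))
    where rotate : ∀ a p h → a * p * h ≡ a * (h * p)
          rotate = solve-∀

  monomialsAboveAll : ∀ {n} → List (Subset n) → ℕ → List (Subset n)
  monomialsAboveAll Ss t = concatMap (λ S → monomialsAbove S t) Ss

  above-all : ∀ {n} {S : Subset n} {Ss t g} → S ∈ₗ Ss → Above S t g → SpannedBy (monomialsAboveAll Ss t) g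
  above-all S∈Ss = spannedBy-⊆ (λ M∈ → Any.concat⁺ (Any.map⁺ (Any.map (λ { refl → M∈ }) S∈Ss)))

  length-monomialsAboveAll : ∀ {n r t} {Ss : List (Subset n)} → All (λ S → ∣ S ∣ ≡ r) Ss →
    length (monomialsAboveAll Ss t) ≡ length Ss ℕ.* binomSum (n ∸ r) t
  length-monomialsAboveAll []                          = refl
  length-monomialsAboveAll {t = t} {S ∷ Ss} (refl ∷ sizes) = trans (length-++ (monomialsAbove S t))
    (cong₂ ℕ._+_ (length-monomialsAbove S t) (length-monomialsAboveAll {t = t} sizes))

module BinomialBounds where

  open import Defs using (binomSum)
  open import Data.Nat using (ℕ; zero; suc; _+_; _*_; _≤_; s≤s)
  open import Data.Nat.Properties
  open import Data.Nat.Combinatorics using (_C_; nCk+nC[k+1]≡[n+1]C[k+1]; nC1≡n)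
  open import Data.Nat.Tactic.RingSolver using (solve-∀)
  open import Data.Sum using (inj₁; inj₂)
  open import Relation.Binary.PropositionalEquality

  C-mono : ∀ {m n} r → m ≤ n → m C r ≤ n C r
  C-mono r m≤n with m≤n⇒m<n∨m≡n m≤n
  ... | inj₂ refl = ≤-refl
  C-mono {n = suc n} r _ | inj₁ (s≤s m≤n) = ≤-trans (C-mono r m≤n) (step r)
    where step : ∀ r → n C r ≤ suc n C r
          step zero    = ≤-refl
          step (suc r) = ≤-trans (m≤n+m (n C suc r) (n C r)) (≤-reflexive (nCk+nC[k+1]≡[n+1]C[k+1] n r))

  C-absorption : ∀ n k → suc k * (suc n C suc k) ≡ suc n * (n C k)
  C-absorption zero    zero    = refl
  C-absorption zero    (suc k) = *-zeroʳ (suc (suc k))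
  C-absorption (suc n) zero    =
    trans (*-identityˡ _) (trans (nC1≡n (suc (suc n))) (sym (*-identityʳ (suc (suc n)))))
  C-absorption (suc n) (suc k) = begin
    suc (suc k) * (suc (suc n) C suc (suc k)) ≡⟨ cong (suc (suc k) *_) (sym (nCk+nC[k+1]≡[n+1]C[k+1] (suc n) (suc k))) ⟩
    suc (suc k) * (x + y)                     ≡⟨ expand k x y ⟩
    suc k * x + x + suc (suc k) * y           ≡⟨ cong₂ (λ a b → a + x + b) (C-absorption n k) (C-absorption n (suc k)) ⟩
    suc n * p + x + suc n * q                 ≡⟨ cong (λ x → suc n * p + x + suc n * q) (sym (nCk+nC[k+1]≡[n+1]C[k+1] n k)) ⟩
    suc n * p + (p + q) + suc n * q           ≡⟨ collect n p q ⟩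
    suc (suc n) * (p + q)                     ≡⟨ cong (suc (suc n) *_) (nCk+nC[k+1]≡[n+1]C[k+1] n k) ⟩
    suc (suc n) * x                           ∎
    where
    open ≡-Reasoning
    x y p q : ℕ
    x = suc n C suc k
    y = suc n C suc (suc k)
    p = n C k
    q = n C suc k
    expand : ∀ k x y → suc (suc k) * (x + y) ≡ suc k * x + x + suc (suc k) * y
    expand = solve-∀
    collect : ∀ n p q → suc n * p + (p + q) + suc n * q ≡ suc (suc n) * (p + q)
    collect = solve-∀

  C-ratio-bound : ∀ K N i → K * suc i ≤ suc N → K * (N C i) ≤ suc N C suc i
  C-ratio-bound K N i K[i+1]≤N+1 = *-cancelˡ-≤ (suc i) (begin
    suc i * (K * (N C i)) ≡⟨ shuffle K i (N C i) ⟩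
    K * suc i * (N C i)   ≤⟨ *-monoˡ-≤ (N C i) K[i+1]≤N+1 ⟩
    suc N * (N C i)       ≡⟨ sym (C-absorption N i) ⟩
    suc i * (suc N C suc i) ∎)
    where
    open ≤-Reasoning
    shuffle : ∀ K i c → suc i * (K * c) ≡ K * suc i * c
    shuffle = solve-∀

  binomSum-bound : ∀ K N t → K * suc t ≤ suc N → K * binomSum N t ≤ binomSum (suc N) (suc t)
  binomSum-bound K N zero    K≤N+1 = ≤-trans (C-ratio-bound K N 0 K≤N+1) (m≤m+n _ 1)
  binomSum-bound K N (suc t) K[t+2]≤N+1 = begin
    K * (N C suc t + binomSum N t)           ≡⟨ *-distribˡ-+ K (N C suc t) (binomSum N t) ⟩
    K * (N C suc t) + K * binomSum N t       ≤⟨ +-mono-≤ (C-ratio-bound K N (suc t) K[t+2]≤N+1)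
                                                   (binomSum-bound K N t (≤-trans (*-monoʳ-≤ K (n≤1+n (suc t))) K[t+2]≤N+1)) ⟩
    suc N C suc (suc t) + binomSum (suc N) (suc t) ∎
    where open ≤-Reasoning

  binomSum-positive : ∀ N s → 1 ≤ binomSum N s
  binomSum-positive N zero    = ≤-refl
  binomSum-positive N (suc s) = ≤-trans (binomSum-positive N s) (m≤n+m _ _)

open import Defs using (capUpTo; capAll; binomSum)
open import Data.Nat using (ℕ; zero; suc; _+_; _*_; _∸_; _^_; _≤_; _<_; z<s; s≤s; _≤?_; _<?_; _≟_; z≤n)
open import Data.Nat.Properties
open import Data.Nat.Combinatorics using (_C_)
open import Data.Nat.Tactic.RingSolver using (solve-∀)
open import Data.Integer using (ℤ; +_; 0ℤ) renaming (_*_ to _*ℤ_; _-_ to _-ℤ_)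
import Data.Integer.Properties as ℤ
open import Data.Fin as Fin using (Fin; zero; suc; toℕ; fromℕ<; inject≤)
open import Data.Fin.Properties using (toℕ-injective; toℕ-fromℕ<; toℕ-inject≤)
open import Data.Fin.Subset using (Subset; _⊆_; _∩_; ∣_∣; ⋃)
open import Data.Fin.Subset.Properties
  using (∩-comm; ⊆-antisym; p∩q⊆p; p∩q⊆q; x∈p∩q⁻; x∈p∩q⁺; p⊆q⇒∣p∣≤∣q∣; ∣p∩q∣≤∣q∣)
open import Data.List using (List; map; length; allFin)
open import Data.List.Properties using (length-map; length-tabulate)
import Data.List.Relation.Unary.All as All
import Data.List.Relation.Unary.All.Properties as All
open import Data.List.Membership.Propositional using () renaming (_∈_ to _∈ₗ_)
open import Data.List.Membership.Propositional.Properties using (∈-map⁺; ∈-allFin)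
open import Data.Product using (∃; _×_; _,_; proj₁; proj₂)
open import Data.Sum using (inj₁; inj₂)
open import Function using (_∘_; id)
open import Function.Definitions using (Injective)
open import Relation.Binary.Definitions using (tri<; tri≈; tri>)
open import Relation.Binary.PropositionalEquality
open import Relation.Nullary using (¬_; Dec; yes; no; contradiction)
open IntegerLinearAlgebra
open SubsetFacts
open SubsetEnumeration
open MultilinearPolynomials
open BinomialBounds

increasing-min : ∀ {t} (l : Fin (suc t) → ℕ) → (∀ (a b : Fin (suc t)) → toℕ a < toℕ b → l a < l b) →
                 ∀ a → l zero ≤ l a
increasing-min l l-increasing zero    = ≤-refl
increasing-min l l-increasing (suc a) = <⇒≤ (l-increasing zero (suc a) z<s)

-- The configuration of the proposition, with indices counted from 0: the "first block"
-- B_1, …, B_{k+1} of the paper consists of the B_j with toℕ j < k + 1.  Assuming k ≥ 1,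
-- we build m polynomials f_j in the span of few monomials whose values f_j(A_i) form a
-- triangular matrix with nonzero diagonal.
module Configuration
  (n m t k : ℕ) (l : Fin (suc t) → ℕ)
  (l-increasing : ∀ (a b : Fin (suc t)) → toℕ a < toℕ b → l a < l b)
  (A B : Fin m → Subset n)
  (B-injective : Injective _≡_ _≡_ B)
  (∣B∣≤k : ∀ j → ∣ B j ∣ ≤ k)
  (k+1≤m : k + 1 ≤ m)
  (1≤k : 1 ≤ k)
  (cross : ∀ (i j : Fin m) → toℕ i < toℕ j → ∃ λ a → ∣ A i ∩ B j ∣ ≡ l a)
  (B⊆A : ∀ i → B i ⊆ A i)
  (diagonal-outside : ∀ (i : Fin m) → k + 1 ≤ toℕ i → ¬ (∃ λ a → ∣ A i ∩ B i ∣ ≡ l a))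
  (capUpTo≡capAll : ∣ capUpTo B (k + 1) ∣ ≡ ∣ capAll B ∣)
  (∣capAll∣<l₀ : ∣ capAll B ∣ < l zero)
  (A≡B-first : ∀ (i : Fin m) → toℕ i < k + 1 → A i ≡ B i)
  where

  l₀ : ℕ
  l₀ = l zero

  ∣A∩B∣≡∣B∣ : ∀ j → ∣ A j ∩ B j ∣ ≡ ∣ B j ∣
  ∣A∩B∣≡∣B∣ j = cong ∣_∣ (⊆⇒∩≡ (B⊆A j))

  First : Fin m → Set
  First j = toℕ j < k + 1

  -- Since A_i = B_i in the first block, (i) gives |B_i ∩ B_j| ∈ L for first i and any j ≠ i.
  first-meets : ∀ i j → First i → i ≢ j → ∃ λ a → ∣ B i ∩ B j ∣ ≡ l a
  first-meets i j i-first i≢j with <-cmp (toℕ i) (toℕ j)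
  ... | tri< i<j _ _ = let (a , e) = cross i j i<j in
    a , subst (λ X → ∣ X ∩ B j ∣ ≡ l a) (A≡B-first i i-first) e
  ... | tri≈ _ i≡j _ = contradiction (toℕ-injective i≡j) i≢j
  ... | tri> _ _ j<i = let (a , e) = cross j i j<i in
    a , trans (cong ∣_∣ (∩-comm (B i) (B j))) (subst (λ X → ∣ X ∩ B i ∣ ≡ l a) (A≡B-first j (<-trans j<i i-first)) e)

  firstAt : ∀ r → r < k + 1 → Fin m
  firstAt r r<k+1 = fromℕ< (<-≤-trans r<k+1 k+1≤m)

  toℕ-firstAt : ∀ r (r<k+1 : r < k + 1) → toℕ (firstAt r r<k+1) ≡ r
  toℕ-firstAt r r<k+1 = toℕ-fromℕ< (<-≤-trans r<k+1 k+1≤m)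

  first-firstAt : ∀ r (r<k+1 : r < k + 1) → First (firstAt r r<k+1)
  first-firstAt r r<k+1 = subst (_< k + 1) (sym (toℕ-firstAt r r<k+1)) r<k+1

  1<k+1 : 1 < k + 1
  1<k+1 = +-monoˡ-≤ 1 1≤k

  0<k+1 : 0 < k + 1
  0<k+1 = <⇒≤ 1<k+1

  -- As k ≥ 1 the first block has two members, so every j has a first i ≠ j.
  another-first : ∀ j → ∃ λ i → First i × i ≢ j
  another-first j with toℕ j ≟ 0
  ... | yes j≡0 = firstAt 1 1<k+1 , first-firstAt 1 1<k+1 ,
                  λ i≡j → 1+n≢0 (trans (sym (toℕ-firstAt 1 1<k+1)) (trans (cong toℕ i≡j) j≡0))
  ... | no  j≢0 = firstAt 0 0<k+1 , first-firstAt 0 0<k+1 ,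
                  λ i≡j → j≢0 (trans (cong toℕ (sym i≡j)) (toℕ-firstAt 0 0<k+1))

  firstBlock : List (Subset n)
  firstBlock = map (λ r → B (inject≤ r k+1≤m)) (allFin (k + 1))

  U : Subset n
  U = ⋃ firstBlock

  B⊆U : ∀ i → First i → B i ⊆ U
  B⊆U i i-first = subst (λ j → B j ⊆ U) (toℕ-injective (trans (toℕ-inject≤ _ k+1≤m) (toℕ-fromℕ< i-first)))
                        (⊆-⋃ (∈-map⁺ (λ r → B (inject≤ r k+1≤m)) (∈-allFin (fromℕ< i-first))))

  ∣U∣≤k²+k : ∣ U ∣ ≤ k ^ 2 + k
  ∣U∣≤k²+k = begin
    ∣ U ∣                   ≤⟨ ∣⋃∣≤ (All.map⁺ (All.tabulate⁺ (λ r → ∣B∣≤k (inject≤ r k+1≤m)))) ⟩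
    length firstBlock * k   ≡⟨ cong (_* k) (trans (length-map _ (allFin (k + 1))) (length-tabulate {n = k + 1} id)) ⟩
    (k + 1) * k             ≡⟨ square k ⟩
    k ^ 2 + k               ∎
    where open ≤-Reasoning
          square : ∀ x → (x + 1) * x ≡ x * (x * 1) + x   -- x ^ 2 unfolds to x * (x * 1)
          square = solve-∀

  -- Every B_j meets U in more than l₀ points.  Otherwise W = B_j ∩ U has at most l₀ points
  -- but contains B_i ∩ B_j, of size ≥ l₀, for every first i ≠ j; so W = B_i ∩ B_j ⊆ B_i.
  -- Then W lies in the intersection of the first block, which has fewer than l₀ points
  -- by (iii), while W has at least l₀.
  B∩U-large : ∀ j → suc l₀ ≤ ∣ B j ∩ U ∣
  B∩U-large j with suc l₀ ≤? ∣ B j ∩ U ∣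
  ... | yes large = large
  ... | no  small = contradiction (begin-strict
        l₀                       ≤⟨ l₀≤∣W∣ ⟩
        ∣ W ∣                    ≤⟨ p⊆q⇒∣p∣≤∣q∣ W⊆cap ⟩
        ∣ capUpTo B (k + 1) ∣    ≡⟨ capUpTo≡capAll ⟩
        ∣ capAll B ∣             <⟨ ∣capAll∣<l₀ ⟩
        l₀                       ∎) (<-irrefl refl)
    where
    open ≤-Reasoning
    W : Subset n
    W = B j ∩ U
    meet⊆W : ∀ i → First i → B i ∩ B j ⊆ W
    meet⊆W i i-first x∈ = let (x∈Bi , x∈Bj) = x∈p∩q⁻ (B i) (B j) x∈ in x∈p∩q⁺ (x∈Bj , B⊆U i i-first x∈Bi)
    l₀≤meet : ∀ i → First i → i ≢ j → l₀ ≤ ∣ B i ∩ B j ∣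
    l₀≤meet i i-first i≢j = let (a , e) = first-meets i j i-first i≢j in
                            subst (l₀ ≤_) (sym e) (increasing-min l l-increasing a)
    W⊆B : ∀ i → First i → W ⊆ B i
    W⊆B i i-first with i Fin.≟ j
    ... | yes refl = p∩q⊆p (B i) U
    ... | no  i≢j  = p∩q⊆p (B i) (B j) ∘
                     ⊆-card (meet⊆W i i-first) (≤-trans (≤-pred (≰⇒> small)) (l₀≤meet i i-first i≢j))
    W⊆cap : W ⊆ capUpTo B (k + 1)
    W⊆cap x∈W = ∈-capUpTo B (k + 1) (λ i i-first → W⊆B i i-first x∈W)
    l₀≤∣W∣ : l₀ ≤ ∣ W ∣
    l₀≤∣W∣ = let (i , i-first , i≢j) = another-first j in
             ≤-trans (l₀≤meet i i-first i≢j) (p⊆q⇒∣p∣≤∣q∣ (meet⊆W i i-first))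

  chosen : ∀ j → ∃ λ S → S ⊆ B j ∩ U × ∣ S ∣ ≡ suc l₀
  chosen j = choose-subset (B j ∩ U) (suc l₀) (B∩U-large j)

  S : Fin m → Subset n
  S j = proj₁ (chosen j)

  S⊆B : ∀ j → S j ⊆ B j
  S⊆B j = p∩q⊆p (B j) U ∘ proj₁ (proj₂ (chosen j))

  baseSets : List (Subset n)
  baseSets = ofSize U (suc l₀)

  S∈baseSets : ∀ j → S j ∈ₗ baseSets
  S∈baseSets j = ofSize-complete (p∩q⊆q (B j) U ∘ proj₁ (proj₂ (chosen j))) (proj₂ (proj₂ (chosen j)))

  -- The factor for l_{b+1}: x ↦ |x ∩ B_j| − l_{b+1}, replaced by 1 when l_{b+1} = |B_j|
  -- so that no factor vanishes at A_j.
  factor : Fin m → Fin t → Factor n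
  factor j b with l (suc b) ≟ ∣ B j ∣
  ... | yes _ = one
  ... | no  _ = affine (B j) (l (suc b))

  factor-vanishes : ∀ j b x → ∣ x ∩ B j ∣ ≡ l (suc b) → l (suc b) ≢ ∣ B j ∣ → ⟦ factor j b ⟧ x ≡ 0ℤ
  factor-vanishes j b x ∣x∩B∣≡l l≢∣B∣ with l (suc b) ≟ ∣ B j ∣
  ... | yes l≡∣B∣ = contradiction l≡∣B∣ l≢∣B∣
  ... | no  _     = trans (cong (λ c → + c -ℤ + l (suc b)) ∣x∩B∣≡l) (ℤ.+-inverseʳ (+ l (suc b)))

  factor-at-A : ∀ j b → ⟦ factor j b ⟧ (A j) ≢ 0ℤ
  factor-at-A j b with l (suc b) ≟ ∣ B j ∣
  ... | yes _     = λ ()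
  ... | no  l≢∣B∣ = λ diff≡0 → l≢∣B∣ (sym (trans (sym (∣A∩B∣≡∣B∣ j))
                                  (ℤ.+-injective (ℤ.i-j≡0⇒i≡j (+ ∣ A j ∩ B j ∣) (+ l (suc b)) diff≡0))))

  f : Fin m → Subset n → ℤ
  f j x = monomial (S j) x *ℤ product (λ b → ⟦ factor j b ⟧ x)

  f-spanned : ∀ j → SpannedBy (monomialsAboveAll baseSets t) (f j)
  f-spanned j = above-all {t = t} (S∈baseSets j) (above-product (S j) (factor j))

  -- f_j(A_j) = 1 · ∏_b factor_{j,b}(A_j) ≠ 0, since S_j ⊆ B_j ⊆ A_j.
  f-diagonal : ∀ j → f j (A j) ≢ 0ℤ
  f-diagonal j = subst (_≢ 0ℤ) (sym (trans (cong (_*ℤ value) (monomial-⊆ (B⊆A j ∘ S⊆B j))) (ℤ.*-identityˡ value)))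
                       (product-nonzero (λ b → ⟦ factor j b ⟧ (A j)) (factor-at-A j))
    where value : ℤ
          value = product (λ b → ⟦ factor j b ⟧ (A j))

  -- The order in which f_j(A_i) is triangular: first-block indices by |B_j| (at most k),
  -- the remaining ones by their position (at least k + 1).
  key : Fin m → ℕ
  key j with toℕ j <? k + 1
  ... | yes _ = ∣ B j ∣
  ... | no  _ = toℕ j

  key-first : ∀ j → First j → key j ≡ ∣ B j ∣
  key-first j j-first with toℕ j <? k + 1
  ... | yes _       = refl
  ... | no  j-later = contradiction j-first j-later

  key-later : ∀ j → ¬ First j → key j ≡ toℕ j
  key-later j j-later with toℕ j <? k + 1
  ... | yes j-first = contradiction j-first j-later
  ... | no  _       = refl

  Below : Fin m → Fin m → Set
  Below i j = ∃ λ a → ∣ A i ∩ B j ∣ ≡ l a × l a < ∣ B j ∣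

  -- Column j outside the first block and i < j: (i) gives |A_i ∩ B_j| = l_a ≤ |B_j|, and
  -- l_a ≠ |B_j| = |A_j ∩ B_j| since the latter is not in L by (ii).
  below-later : ∀ i j → ¬ First j → toℕ i < toℕ j → Below i j
  below-later i j j-later i<j = let (a , e) = cross i j i<j in
    a , e , ≤∧≢⇒< (subst (_≤ ∣ B j ∣) e (∣p∩q∣≤∣q∣ (A i) (B j)))
                   (λ la≡∣B∣ → diagonal-outside j (≮⇒≥ j-later) (a , trans (∣A∩B∣≡∣B∣ j) (sym la≡∣B∣)))

  -- i ≠ j both in the first block with |B_i| ≤ |B_j|: |B_i ∩ B_j| = l_a, and l_a = |B_j|
  -- would give B_j ⊆ B_i, hence B_i = B_j by size, contradicting injectivity of B.
  below-first : ∀ i j → First i → i ≢ j → ∣ B i ∣ ≤ ∣ B j ∣ → Below i j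
  below-first i j i-first i≢j ∣Bi∣≤∣Bj∣ = let (a , e) = first-meets i j i-first i≢j in
    a , subst (λ X → ∣ X ∩ B j ∣ ≡ l a) (sym (A≡B-first i i-first)) e ,
    ≤∧≢⇒< (subst (_≤ ∣ B j ∣) e (∣p∩q∣≤∣q∣ (B i) (B j)))
          (λ la≡∣Bj∣ → i≢j (Bi≡Bj (trans e la≡∣Bj∣)))
    where
    Bi≡Bj : ∣ B i ∩ B j ∣ ≡ ∣ B j ∣ → i ≡ j
    Bi≡Bj ∣Bi∩Bj∣≡∣Bj∣ = B-injective (⊆-antisym (⊆-card Bj⊆Bi ∣Bi∣≤∣Bj∣) Bj⊆Bi)
      where Bj⊆Bi : B j ⊆ B i
            Bj⊆Bi = p∩q⊆p (B i) (B j) ∘ ⊆-card (p∩q⊆q (B i) (B j)) (≤-reflexive (sym ∣Bi∩Bj∣≡∣Bj∣))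

  -- Every entry strictly below the diagonal in the key order is Below: a later column is
  -- handled by below-later, a first column with a first row by below-first, and a first
  -- column with a later row is impossible since then key j ≤ k < key i.
  below-diagonal : ∀ i j → i ≢ j → key i ≤ key j → Below i j
  below-diagonal i j i≢j key≤ = by-cases (toℕ i <? k + 1) (toℕ j <? k + 1)
    where
    open ≤-Reasoning
    by-cases : Dec (First i) → Dec (First j) → Below i j
    by-cases (yes i-first) (yes j-first) =
      below-first i j i-first i≢j (subst₂ _≤_ (key-first i i-first) (key-first j j-first) key≤)
    by-cases (yes i-first) (no j-later) = below-later i j j-later (<-≤-trans i-first (≮⇒≥ j-later))
    by-cases (no i-later)  (no j-later) = below-later i j j-later
      (≤∧≢⇒< (subst₂ _≤_ (key-later i i-later) (key-later j j-later) key≤) (i≢j ∘ toℕ-injective))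
    by-cases (no i-later)  (yes j-first) = contradiction key≤ (<⇒≱ (begin-strict
      key j   ≡⟨ key-first j j-first ⟩
      ∣ B j ∣ ≤⟨ ∣B∣≤k j ⟩
      k       <⟨ ≤-trans (≤-reflexive (+-comm 1 k)) (≮⇒≥ i-later) ⟩
      toℕ i   ≡⟨ key-later i i-later ⟨
      key i   ∎))

  S⊆⇒large : ∀ j x → S j ⊆ x → suc l₀ ≤ ∣ x ∩ B j ∣
  S⊆⇒large j x S⊆x = subst (_≤ ∣ x ∩ B j ∣) (proj₂ (proj₂ (chosen j)))
                             (p⊆q⇒∣p∣≤∣q∣ (λ y∈S → x∈p∩q⁺ (S⊆x y∈S , S⊆B j y∈S)))

  -- Below the diagonal f_j(A_i) = 0: either S_j ⊄ A_i, or |A_i ∩ B_j| ≥ l₀ + 1, so the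
  -- value l_a from below-diagonal is some l_{b+1} ≠ |B_j| and the factor for l_{b+1} vanishes.
  f-lower : ∀ i j → i ≢ j → key i ≤ key j → f j (A i) ≡ 0ℤ
  f-lower i j i≢j key≤ with monomial-⊈ (S j) (A i)
  ... | inj₁ x^S≡0 = trans (cong (_*ℤ value) x^S≡0) (ℤ.*-zeroˡ value)
    where value : ℤ
          value = product (λ b → ⟦ factor j b ⟧ (A i))
  ... | inj₂ S⊆A with below-diagonal i j i≢j key≤
  ...   | zero  , ∣A∩B∣≡l₀ , _ =
          contradiction (subst (suc l₀ ≤_) ∣A∩B∣≡l₀ (S⊆⇒large j (A i) S⊆A)) (<-irrefl refl)
  ...   | suc b , ∣A∩B∣≡l , l<∣B∣ = trans
          (cong (monomial (S j) (A i) *ℤ_) (product-zero (λ b → ⟦ factor j b ⟧ (A i)) b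
                                             (factor-vanishes j b (A i) ∣A∩B∣≡l (<⇒≢ l<∣B∣))))
          (ℤ.*-zeroʳ (monomial (S j) (A i)))

  m≤dimension : m ≤ ((k ^ 2 + k) C suc l₀) * binomSum (n ∸ suc l₀) t
  m≤dimension = begin
    m                                                ≤⟨ rank-bound _ f A key f-spanned f-lower f-diagonal ⟩
    length (monomialsAboveAll baseSets t)            ≡⟨ length-monomialsAboveAll {t = t} baseSets-sizes ⟩
    length baseSets * binomSum (n ∸ suc l₀) t        ≤⟨ *-monoˡ-≤ _ (≤-trans (≤-reflexive (length-ofSize U (suc l₀)))
                                                                             (C-mono (suc l₀) ∣U∣≤k²+k)) ⟩
    ((k ^ 2 + k) C suc l₀) * binomSum (n ∸ suc l₀) t ∎
    where open ≤-Reasoning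
          baseSets-sizes : All.All (λ S → ∣ S ∣ ≡ suc l₀) baseSets
          baseSets-sizes = All.map proj₂ (ofSize-sound U (suc l₀))

-- With at least two sets, k ≥ 1: by (i) the set B_2 meets A_1 in l_a ≥ l_1 > 0 points.
k-positive : ∀ {n m t k} (l : Fin (suc t) → ℕ) → 0 < l zero →
  (∀ (a b : Fin (suc t)) → toℕ a < toℕ b → l a < l b) → (A B : Fin m → Subset n) →
  (∀ j → ∣ B j ∣ ≤ k) → (∀ (i j : Fin m) → toℕ i < toℕ j → ∃ λ a → ∣ A i ∩ B j ∣ ≡ l a) →
  2 ≤ m → 1 ≤ k
k-positive {m = m} {k = k} l 0<l₀ l-increasing A B ∣B∣≤k cross 2≤m =
  let (a , e) = cross first second first<second in begin
    1                            ≤⟨ 0<l₀ ⟩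
    l zero                       ≤⟨ increasing-min l l-increasing a ⟩
    l a                          ≡⟨ e ⟨
    ∣ A first ∩ B second ∣       ≤⟨ ∣p∩q∣≤∣q∣ (A first) (B second) ⟩
    ∣ B second ∣                 ≤⟨ ∣B∣≤k second ⟩
    k                            ∎
  where
  open ≤-Reasoning
  first second : Fin m
  first  = fromℕ< (<⇒≤ 2≤m)
  second = fromℕ< 2≤m
  first<second : toℕ first < toℕ second
  first<second = subst₂ _<_ (sym (toℕ-fromℕ< (<⇒≤ 2≤m))) (sym (toℕ-fromℕ< 2≤m)) z<s

-- Consequences of the hypothesis n ≥ (K + 1)(t + 1) + l₀: with N = n − (l₀ + 1) we have
-- n − l₀ = N + 1 and K(t + 1) ≤ N + 1, the form needed by binomSum-bound.
module SizeCondition (n t l₀ K : ℕ) (n-large : (K + 1) * suc t + l₀ ≤ n) where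

  [K+1][t+1]≤n∸l₀ : (K + 1) * suc t ≤ n ∸ l₀
  [K+1][t+1]≤n∸l₀ = m+n≤o⇒m≤o∸n ((K + 1) * suc t) n-large

  n∸l₀≡1+N : n ∸ l₀ ≡ suc (n ∸ suc l₀)
  n∸l₀≡1+N = +-∸-assoc 1 {n} {suc l₀} (m∸n≢0⇒n<m λ n∸l₀≡0 →
    contradiction (subst (1 ≤_) n∸l₀≡0 (≤-trans (*-mono-≤ (m≤n+m 1 K) (s≤s z≤n)) [K+1][t+1]≤n∸l₀)) λ ())

  K[t+1]≤1+N : K * suc t ≤ suc (n ∸ suc l₀)
  K[t+1]≤1+N = ≤-trans (*-monoˡ-≤ (suc t) (m≤m+n K 1)) (≤-trans [K+1][t+1]≤n∸l₀ (≤-reflexive n∸l₀≡1+N))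

proposition3p3 : (n m t k : ℕ) (l : Fin (suc t) → ℕ)
    → 0 < l zero
    → (∀ (a b : Fin (suc t)) → toℕ a < toℕ b → l a < l b)
    → (A B : Fin m → Subset n)
    → Injective _≡_ _≡_ A
    → Injective _≡_ _≡_ B
    → (∀ j → ∣ B j ∣ ≤ k)
    → (∃ λ j → ∣ B j ∣ ≡ k)
    → k + 1 ≤ m
    → (∀ (i j : Fin m) → toℕ i < toℕ j → ∃ λ a → ∣ A i ∩ B j ∣ ≡ l a)
    → (∀ i → B i ⊆ A i)
    → (∀ (i : Fin m) → k + 1 ≤ toℕ i → ¬ (∃ λ a → ∣ A i ∩ B i ∣ ≡ l a))
    → ∣ capUpTo B (k + 1) ∣ ≡ ∣ capAll B ∣
    → ∣ capAll B ∣ < l zero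
    → (∀ (i : Fin m) → toℕ i < k + 1 → A i ≡ B i)
    → ((k ^ 2 + k) C (l zero + 1) + 1) * suc t + l zero ≤ n
    → m ≤ binomSum (n ∸ l zero) (suc t)
-- For m ≤ 1 the bound is trivial.  Otherwise k ≥ 1, the configuration gives
-- m ≤ C(k² + k, l₁ + 1) · Σ_{i≤t} C(n − l₁ − 1, i), and the size condition on n turns this
-- into Σ_{i≤t+1} C(n − l₁, i).
proposition3p3 n m t k l 0<l₀ l-increasing A B _ B-injective ∣B∣≤k _ k+1≤m cross B⊆A
               diagonal-outside capUpTo≡capAll ∣capAll∣<l₀ A≡B-first n-large with m ≤? 1
... | yes m≤1 = ≤-trans m≤1 (binomSum-positive (n ∸ l zero) (suc t))
... | no  m≰1 = begin
  m                                         ≤⟨ m≤dimension ⟩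
  K * binomSum (n ∸ suc (l zero)) t         ≤⟨ binomSum-bound K (n ∸ suc (l zero)) t K[t+1]≤1+N ⟩
  binomSum (suc (n ∸ suc (l zero))) (suc t) ≡⟨ cong (λ N → binomSum N (suc t)) n∸l₀≡1+N ⟨
  binomSum (n ∸ l zero) (suc t)             ∎
  where
  open ≤-Reasoning
  K : ℕ
  K = (k ^ 2 + k) C suc (l zero)
  open Configuration n m t k l l-increasing A B B-injective ∣B∣≤k k+1≤m
         (k-positive l 0<l₀ l-increasing A B ∣B∣≤k cross (≰⇒> m≰1)) cross B⊆A diagonal-outside
         capUpTo≡capAll ∣capAll∣<l₀ A≡B-first using (m≤dimension)
  open SizeCondition n t (l zero) K
         (subst (λ r → ((k ^ 2 + k) C r + 1) * suc t + l zero ≤ n) (+-comm (l zero) 1) n-large)
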